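{- Let $a\geqslant 1$ be an integer and let $\Omega$ be a subset of $\mathbb{Z}_{2a}$ such that for every $g\in\Omega$ one has $|g|>2$ and $-g\in\Omega$. Let $\Psi$ be an abelian group of order $2^\alpha$ with $\alpha\geqslant 2$. Then there exists a set $\mathcal{T}$ of $|\Omega|/2$ arrays of size $2\times 2^\alpha$ with entries in $\mathbb{Z}_{2a}\oplus\Psi$, each of which has all row sums and all column sums equal to $0$, such that the list of all entries of all arrays in $\mathcal{T}$ (counted with multiplicity) is exactly the set $\{(x,y): x\in\Omega,\ y\in\Psi\}\subseteq\mathbb{Z}_{2a}\oplus\Psi$, each element appearing exactly once.
   Context: $|g|$ denotes the order of the group element $g$. -}

module Defs where

open import Data.Nat as ℕ using (ℕ; zero; suc; NonZero; _<_; _∸_)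
open import Data.Nat.DivMod using (_mod_)
open import Data.Fin using (Fin; toℕ)
open import Data.Fin.Subset using (Subset; _∈_)
open import Data.Fin.Subset.Properties using (_∈?_)
open import Data.List using (List; []; _∷_; map; concatMap; allFin; filter)
open import Data.Product using (_×_; _,_)
open import Function using (_∘_)
open import Relation.Binary.PropositionalEquality using (_≡_)
open import Relation.Nullary using (¬_)

nonZero-2* : ∀ a → .{{_ : NonZero a}} → NonZero (2 ℕ.* a)
nonZero-2* (suc a) = _

-- The cyclic group ℤ_n, represented by Fin n with arithmetic mod n.
ZMod : ℕ → Set
ZMod n = Fin n

module ZOps (n : ℕ) {{_ : NonZero n}} where
  0ᶻ : ZMod n
  0ᶻ = 0 mod n

  infixl 6 _+ᶻ_
  _+ᶻ_ : ZMod n → ZMod n → ZMod n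
  x +ᶻ y = (toℕ x ℕ.+ toℕ y) mod n

  -ᶻ_ : ZMod n → ZMod n
  -ᶻ x = (n ∸ toℕ x) mod n

  _·ᶻ_ : ℕ → ZMod n → ZMod n
  zero  ·ᶻ g = 0ᶻ
  suc k ·ᶻ g = g +ᶻ (k ·ᶻ g)

  IsOrderOf : ZMod n → ℕ → Set
  IsOrderOf g k = (0 < k) × (k ·ᶻ g ≡ 0ᶻ) × (∀ j → 0 < j → j < k → ¬ (j ·ᶻ g ≡ 0ᶻ))

  OrderGreaterThan2 : ZMod n → Set
  OrderGreaterThan2 g = ∀ k → IsOrderOf g k → 2 < k

module Z2a (a : ℕ) {{nz : NonZero a}} where
  open ZOps (2 ℕ.* a) {{nonZero-2* a}} public

elements : ∀ {n} → Subset n → List (Fin n)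
elements {n} Ω = filter (_∈? Ω) (allFin n)

bigop : {A : Set} → (A → A → A) → A → ∀ {k} → (Fin k → A) → A
bigop _∙_ e {zero}  f = e
bigop _∙_ e {suc k} f = f Fin.zero ∙ bigop _∙_ e (f ∘ Fin.suc)

_⊕op_ : {A B : Set} → (A → A → A) → (B → B → B) → (A × B) → (A × B) → (A × B)
(f ⊕op g) (a , b) (a' , b') = f a a' , g b b'

Array : Set → ℕ → ℕ → Set
Array A r c = Fin r → Fin c → A

ZeroSums : {A : Set} → (A → A → A) → A → ∀ {r c} → Array A r c → Set
ZeroSums _∙_ e {r} {c} M =
  (∀ i → bigop _∙_ e (λ j → M i j) ≡ e) × (∀ j → bigop _∙_ e (λ i → M i j) ≡ e)

entries : {A : Set} → ∀ {m r c} → (Fin m → Array A r c) → List A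
entries {m = m} {r} {c} T =
  concatMap (λ t → concatMap (λ i → map (T t i) (allFin c)) (allFin r)) (allFin m)

-- Ψ has even order, so inversion cannot pair off all of its non-identity elements: there is
-- c ≠ ε with c ∙ c = ε.  Translation by c is a fixed-point-free involution of Ψ, so choosing one
-- element from each pair {y , y ∙ c} gives r₁ … r₂ₖ (where |Ψ| = 4k) with Ψ = {rᵢ} ⊔ {rᵢ ∙ c}.
-- Likewise Ω splits into pairs {x , -x}, as no element of Ω has order ≤ 2.  For one x of each
-- pair take the 2 × 4k array with first row (x , r₁) … (x , r₂ₖ) (-x , (r₁ ∙ c)⁻¹) …
-- (-x , (r₂ₖ ∙ c)⁻¹) and second row its negative.  Its columns sum to zero by construction,
-- its rows because Σ (rᵢ ∙ c) = Σ rᵢ ∙ c ^ 2k = Σ rᵢ, and its entries are exactly {x , -x} × Ψ.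

module Submission where

open import Defs
open import Algebra.Bundles using (AbelianGroup; Group)
open import Algebra.Core using (Op₁; Op₂)
open import Algebra.Structures using (IsAbelianGroup; IsGroup)
import Algebra.Solver.CommutativeMonoid as CommutativeMonoidSolver
open import Data.Bool using (true; false)
open import Data.Empty using (⊥-elim)
open import Data.Fin using (Fin; zero; suc; toℕ; splitAt; _<_; _<?_; _≟_)
open import Data.Fin.Patterns using (0F; 1F)
open import Data.Fin.Properties using (<-cmp; <-asym; any?; toℕ-injective; toℕ-fromℕ<; toℕ<n)
open import Data.Fin.Subset using (Subset; _∈_; ∣_∣; inside; outside)
open import Data.Fin.Subset.Properties using (_∈?_)
open import Data.List using (List; []; _∷_; _++_; map; filter; length; allFin; tabulate; concat; concatMap)
open import Data.List.Properties
  using (length-++; length-map; length-tabulate; map-tabulate; tabulate-cong; map-∘; map-id; map-cong; map-++;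
         concatMap-map; concatMap-++)
open import Data.List.Membership.Propositional using () renaming (_∈_ to _∈ₗ_)
open import Data.List.Membership.Propositional.Properties
  using (∈-++⁻; ∈-++⁺ˡ; ∈-++⁺ʳ; ∈-map⁺; ∈-map⁻; ∈-filter⁺; ∈-filter⁻; ∈-allFin)
open import Data.List.Membership.Propositional.Properties.WithK using (unique∧set⇒bag)
import Data.List.Relation.Unary.All as All
open import Data.List.Relation.Unary.AllPairs using (_∷_)
open import Data.List.Relation.Unary.Any using (here; there)
open import Data.List.Relation.Unary.Unique.Propositional using (Unique)
import Data.List.Relation.Unary.Unique.Propositional.Properties as Unique
open import Data.List.Relation.Binary.BagAndSetEquality
  using (bag; _∼[_]_; [_]-Equality; commutativeMonoid; ∼bag⇒↭; >>=-cong; >>=-left-distributive; ++-cong)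
  renaming (map-cong to map-cong-∼)
open import Data.List.Relation.Binary.Permutation.Propositional using (_↭_)
open import Data.List.Relation.Binary.Permutation.Propositional.Properties using (↭-length)
open import Data.Nat as ℕ using (ℕ; NonZero; _≤_; _*_; _^_; _%_; _∸_; ⌊_/2⌋; z≤n; s≤s)
open import Data.Nat.DivMod using (_mod_; %-distribˡ-+; m%n%n≡m%n; n%n≡0; m<n⇒m%n≡m)
open import Data.Nat.Properties
  using (+-comm; +-assoc; +-identityʳ; m+[n∸m]≡n; <⇒≤; n≮n; even≢odd; n≡⌊n+n/2⌋)
open import Data.Product as Product using (_×_; _,_; ∃; proj₁; proj₂)
open import Data.Sum using (inj₁; inj₂)
open import Data.Sum.Properties using ([,]-map)
open import Data.Vec using ([]; _∷_)
open import Data.Vec.Functional using (Vector; toList; fromList; foldr; tail; replicate)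
  renaming (_++_ to _++ᵛ_; [] to []ᵛ)
open import Data.Vec.Functional.Properties using (toList∘fromList)
open import Function using (id; _∘_; mk⇔)
open import Function.Related.Propositional using (SymmetricKind)
open import Relation.Binary.Bundles using (Setoid)
open import Relation.Binary.Definitions using (tri<; tri≈; tri>)
open import Relation.Binary.PropositionalEquality
import Relation.Binary.Reasoning.Setoid as SetoidReasoning
open import Relation.Nullary using (¬_; ¬?; does; yes; no; contradiction)
open import Relation.Nullary.Decidable using (_×-dec_)

involutive⇒injective : ∀ {A : Set} {f : A → A} → (∀ x → f (f x) ≡ x) → ∀ {x y} → f x ≡ f y → x ≡ y
involutive⇒injective {f = f} f-involutive {x} {y} fx≡fy =
  trans (sym (f-involutive x)) (trans (cong f fx≡fy) (f-involutive y))

⌊2*n/2⌋≡n : ∀ n → ⌊ 2 * n /2⌋ ≡ n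
⌊2*n/2⌋≡n n = trans (cong (λ m → ⌊ n ℕ.+ m /2⌋) (+-identityʳ n)) (sym (n≡⌊n+n/2⌋ n))

fromList-length : ∀ {A : Set} {n} (xs : List A) → length xs ≡ n → ∃ λ (v : Vector A n) → toList v ≡ xs
fromList-length xs refl = fromList xs , toList∘fromList xs

tail-++ᵛ : ∀ {A : Set} {m n} (u : Vector A (ℕ.suc m)) (v : Vector A n) → tail (u ++ᵛ v) ≗ tail u ++ᵛ v
tail-++ᵛ {m = m} u v i = [,]-map (splitAt m i)

toList-++ᵛ : ∀ {A : Set} {m n} (u : Vector A m) (v : Vector A n) → toList (u ++ᵛ v) ≡ toList u ++ toList v
toList-++ᵛ {m = ℕ.zero}  u v = refl
toList-++ᵛ {m = ℕ.suc m} u v =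
  cong (u zero ∷_) (trans (tabulate-cong (tail-++ᵛ u v)) (toList-++ᵛ (tail u) v))

map-involution-allFin : ∀ {n} {f : Fin n → Fin n} → (∀ i → f (f i) ≡ i) → map f (allFin n) ∼[ bag ] allFin n
map-involution-allFin {n} {f} f-involutive = unique∧set⇒bag
  (Unique.map⁺ (involutive⇒injective f-involutive) (Unique.allFin⁺ n)) (Unique.allFin⁺ n)
  (λ {i} → mk⇔ (λ _ → ∈-allFin i)
                (λ _ → subst (_∈ₗ map f (allFin n)) (f-involutive i) (∈-map⁺ f (∈-allFin (f i)))))

map⁺-∼bag : ∀ {A B : Set} (f : A → B) {xs ys : List A} → xs ∼[ bag ] ys → map f xs ∼[ bag ] map f ys
map⁺-∼bag f = map-cong-∼ {f = f} {g = f} (λ _ → refl)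

concatMap-cong-∼bag : ∀ {A B : Set} {f g : A → List B} (xs : List A) →
  (∀ x → f x ∼[ bag ] g x) → concatMap f xs ∼[ bag ] concatMap g xs
concatMap-cong-∼bag {f = f} {g} xs =
  >>=-cong {xs = xs} {f = f} {g = g} (Setoid.refl ([ bag ]-Equality _))

concatMap-orbits : ∀ {A B : Set} {f : A → List B} {σ : A → A} {ys xs : List A} →
  ys ++ map σ ys ∼[ bag ] xs → concatMap (λ y → f y ++ f (σ y)) ys ∼[ bag ] concatMap f xs
concatMap-orbits {B = B} {f} {σ} {ys} {xs} ys++σys∼xs = begin
  concatMap (λ y → f y ++ f (σ y)) ys       ≈⟨ >>=-left-distributive ys ⟩
  concatMap f ys ++ concatMap (f ∘ σ) ys    ≡⟨ cong (concatMap f ys ++_) (concatMap-map f σ ys) ⟨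
  concatMap f ys ++ concatMap f (map σ ys)  ≡⟨ concatMap-++ f ys (map σ ys) ⟨
  concatMap f (ys ++ map σ ys)              ≈⟨ >>=-cong {f = f} {g = f} ys++σys∼xs (λ _ → ∼-refl) ⟩
  concatMap f xs                            ∎
  where
  open SetoidReasoning ([ bag ]-Equality _)
  open Setoid ([ bag ]-Equality B) using () renaming (refl to ∼-refl)

filter-∈?-map-suc : ∀ {n} s (p : Subset n) (xs : List (Fin n)) →
  filter (_∈? (s ∷ p)) (map suc xs) ≡ map suc (filter (_∈? p) xs)
filter-∈?-map-suc s p []       = refl
filter-∈?-map-suc s p (x ∷ xs) with does (x ∈? p)
... | true  = cong (suc x ∷_) (filter-∈?-map-suc s p xs)
... | false = filter-∈?-map-suc s p xs

elements-tail : ∀ {n} s (p : Subset n) → filter (_∈? (s ∷ p)) (tabulate suc) ≡ map suc (elements p)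
elements-tail s p = trans (cong (filter _) (sym (map-tabulate id suc))) (filter-∈?-map-suc s p (allFin _))

length-elements : ∀ {n} (p : Subset n) → length (elements p) ≡ ∣ p ∣
length-elements []            = refl
length-elements (inside ∷ p)  =
  cong ℕ.suc (trans (cong length (elements-tail inside p)) (trans (length-map suc (elements p)) (length-elements p)))
length-elements (outside ∷ p) =
  trans (cong length (elements-tail outside p)) (trans (length-map suc (elements p)) (length-elements p))

elements! : ∀ {n} (p : Subset n) → Unique (elements p)
elements! p = Unique.filter⁺ (_∈? p) (Unique.allFin⁺ _)

∈-elements⁺ : ∀ {n} {p : Subset n} {y} → y ∈ p → y ∈ₗ elements p
∈-elements⁺ = ∈-filter⁺ _ (∈-allFin _)

∈-elements⁻ : ∀ {n} {p : Subset n} {y} → y ∈ₗ elements p → y ∈ p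
∈-elements⁻ {p = p} = proj₂ ∘ ∈-filter⁻ (_∈? p) {xs = allFin _}

allFinExcept : ∀ {n} → Fin n → List (Fin n)
allFinExcept z = filter (λ y → ¬? (y ≟ z)) (allFin _)

∈-allFinExcept⁺ : ∀ {n} {z y : Fin n} → y ≢ z → y ∈ₗ allFinExcept z
∈-allFinExcept⁺ = ∈-filter⁺ _ (∈-allFin _)

∈-allFinExcept⁻ : ∀ {n} {z y : Fin n} → y ∈ₗ allFinExcept z → y ≢ z
∈-allFinExcept⁻ {z = z} = proj₂ ∘ ∈-filter⁻ (λ y → ¬? (y ≟ z)) {xs = allFin _}

allFinExcept! : ∀ {n} (z : Fin n) → Unique (allFinExcept z)
allFinExcept! z = Unique.filter⁺ _ (Unique.allFin⁺ _)

allFin∼∷allFinExcept : ∀ {n} (z : Fin n) → allFin n ∼[ bag ] z ∷ allFinExcept z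
allFin∼∷allFinExcept z = unique∧set⇒bag (Unique.allFin⁺ _)
  (All.tabulate (λ y∈ z≡y → ∈-allFinExcept⁻ y∈ (sym z≡y)) ∷ allFinExcept! z)
  (λ {y} → mk⇔ (λ _ → classify y) (λ _ → ∈-allFin y))
  where
  classify : ∀ y → y ∈ₗ z ∷ allFinExcept z
  classify y with y ≟ z
  ... | yes refl = here refl
  ... | no y≢z   = there (∈-allFinExcept⁺ y≢z)

arrayEntries : ∀ {A : Set} {r c} → Array A r c → List A
arrayEntries M = concatMap (λ i → map (M i) (allFin _)) (allFin _)

entries-∘ : ∀ {X A : Set} {m r c} (F : X → Array A r c) (g : Vector X m) →
  entries (F ∘ g) ≡ concatMap (arrayEntries ∘ F) (toList g)
entries-∘ F g = cong concat (trans (map-tabulate id _) (sym (map-tabulate g _)))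

-- Orbits of an involution

module Orbits {n : ℕ} (σ : Fin n → Fin n) (σ-involutive : ∀ y → σ (σ y) ≡ y) where

  orbitMinima : List (Fin n) → List (Fin n)
  orbitMinima = filter (λ y → y <? σ y)

  module _ {xs : List (Fin n)} (xs! : Unique xs) (σ-closed : ∀ {y} → y ∈ₗ xs → σ y ∈ₗ xs)
           (σ-fixed-point-free : ∀ {y} → y ∈ₗ xs → σ y ≢ y) where

    private
      R : List (Fin n)
      R = orbitMinima xs

      R⊆xs : ∀ {y} → y ∈ₗ R → y ∈ₗ xs
      R⊆xs = proj₁ ∘ ∈-filter⁻ (λ y → y <? σ y) {xs = xs}

      R-minimal : ∀ {y} → y ∈ₗ R → y < σ y
      R-minimal = proj₂ ∘ ∈-filter⁻ (λ y → y <? σ y) {xs = xs}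

      R! : Unique R
      R! = Unique.filter⁺ _ xs!

      R-disjoint-σR : ∀ {y} → ¬ (y ∈ₗ R × y ∈ₗ map σ R)
      R-disjoint-σR (y∈R , y∈σR) with ∈-map⁻ σ y∈σR
      ... | z , z∈R , refl = <-asym (subst (σ z <_) (σ-involutive z) (R-minimal y∈R)) (R-minimal z∈R)

      split : ∀ {y} → y ∈ₗ R ++ map σ R → y ∈ₗ xs
      split y∈ with ∈-++⁻ R y∈
      ... | inj₁ y∈R = R⊆xs y∈R
      ... | inj₂ y∈σR with ∈-map⁻ σ y∈σR
      ...   | z , z∈R , refl = σ-closed (R⊆xs z∈R)

      join : ∀ {y} → y ∈ₗ xs → y ∈ₗ R ++ map σ R
      join {y} y∈xs with <-cmp y (σ y)
      ... | tri< y<σy _ _ = ∈-++⁺ˡ (∈-filter⁺ _ y∈xs y<σy)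
      ... | tri≈ _ y≡σy _ = contradiction (sym y≡σy) (σ-fixed-point-free y∈xs)
      ... | tri> _ _ σy<y = ∈-++⁺ʳ R (subst (_∈ₗ map σ R) (σ-involutive y)
              (∈-map⁺ σ (∈-filter⁺ _ (σ-closed y∈xs) (subst (σ y <_) (sym (σ-involutive y)) σy<y))))

    orbitMinima-++-σ : orbitMinima xs ++ map σ (orbitMinima xs) ∼[ bag ] xs
    orbitMinima-++-σ = unique∧set⇒bag
      (Unique.++⁺ R! (Unique.map⁺ (involutive⇒injective σ-involutive) R!) R-disjoint-σR) xs! (mk⇔ split join)

    length-orbitMinima : length xs ≡ 2 * length (orbitMinima xs)
    length-orbitMinima = begin
      length xs                    ≡⟨ ↭-length (∼bag⇒↭ orbitMinima-++-σ) ⟨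
      length (R ++ map σ R)        ≡⟨ length-++ R ⟩
      length R ℕ.+ length (map σ R) ≡⟨ cong (length R ℕ.+_) (trans (length-map σ R) (sym (+-identityʳ _))) ⟩
      2 * length R                 ∎
      where open ≡-Reasoning

    orbitTransversal : ∀ {m} → ⌊ length xs /2⌋ ≡ m →
      ∃ λ (g : Vector (Fin n) m) → toList g ++ map σ (toList g) ∼[ bag ] xs
    orbitTransversal ⌊|xs|/2⌋≡m =
      let g , g≡R = fromList-length R |R|≡m
      in  g , subst (λ L → L ++ map σ L ∼[ bag ] xs) (sym g≡R) orbitMinima-++-σ
      where
      |R|≡m : length R ≡ _
      |R|≡m = trans (sym (⌊2*n/2⌋≡n (length R))) (trans (cong ⌊_/2⌋ (sym length-orbitMinima)) ⌊|xs|/2⌋≡m)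

-- Groups of even order

module _ {m : ℕ} {_∙_ : Op₂ (Fin (2 * m))} {ε : Fin (2 * m)} {_⁻¹ : Op₁ (Fin (2 * m))}
         (isGroup : IsGroup _≡_ _∙_ ε _⁻¹) where

  private
    G : Group _ _
    G = record { isGroup = isGroup }
  open Group G using (assoc; identityʳ; inverseʳ)
  open import Algebra.Properties.Group G using (⁻¹-involutive; ⁻¹-injective; ε⁻¹≈ε; identityʳ-unique)

  -- Otherwise inversion would pair off the non-identity elements, making 2 * m - 1 even.
  ∃-order-2 : ∃ λ c → c ≢ ε × c ∙ c ≡ ε
  ∃-order-2 with any? (λ y → ¬? (y ≟ ε) ×-dec (y ⁻¹ ≟ y))
  ... | yes (c , c≢ε , c⁻¹≡c) = c , c≢ε , trans (cong (c ∙_) (sym c⁻¹≡c)) (inverseʳ c)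
  ... | no ∄ = ⊥-elim (even≢odd m (length (orbitMinima (allFinExcept ε))) (begin
      2 * m                                              ≡⟨ length-tabulate id ⟨
      length (allFin (2 * m))                            ≡⟨ ↭-length (∼bag⇒↭ (allFin∼∷allFinExcept ε)) ⟩
      ℕ.suc (length (allFinExcept ε))                    ≡⟨ cong ℕ.suc nonIdentity-even ⟩
      ℕ.suc (2 * length (orbitMinima (allFinExcept ε)))  ∎))
    where
    open ≡-Reasoning
    open Orbits _⁻¹ ⁻¹-involutive

    ⁻¹-closed : ∀ {y} → y ∈ₗ allFinExcept ε → y ⁻¹ ∈ₗ allFinExcept ε
    ⁻¹-closed y∈ =
      ∈-allFinExcept⁺ (λ y⁻¹≡ε → ∈-allFinExcept⁻ y∈ (⁻¹-injective (trans y⁻¹≡ε (sym ε⁻¹≈ε))))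

    ⁻¹-fixed-point-free : ∀ {y} → y ∈ₗ allFinExcept ε → y ⁻¹ ≢ y
    ⁻¹-fixed-point-free {y} y∈ y⁻¹≡y = ∄ (y , ∈-allFinExcept⁻ y∈ , y⁻¹≡y)

    nonIdentity-even : length (allFinExcept ε) ≡ 2 * length (orbitMinima (allFinExcept ε))
    nonIdentity-even = length-orbitMinima (allFinExcept! ε) ⁻¹-closed ⁻¹-fixed-point-free

  cosetTransversal : ∀ {c} → c ≢ ε → c ∙ c ≡ ε →
    ∃ λ (r : Vector (Fin (2 * m)) m) → toList r ++ map (_∙ c) (toList r) ∼[ bag ] allFin (2 * m)
  cosetTransversal {c} c≢ε c∙c≡ε =
    orbitTransversal (Unique.allFin⁺ _) (λ _ → ∈-allFin _) ∙c-fixed-point-free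
      (trans (cong ⌊_/2⌋ (length-tabulate id)) (⌊2*n/2⌋≡n m))
    where
    ∙c-involutive : ∀ y → (y ∙ c) ∙ c ≡ y
    ∙c-involutive y = trans (assoc y c c) (trans (cong (y ∙_) c∙c≡ε) (identityʳ y))
    open Orbits (_∙ c) ∙c-involutive
    ∙c-fixed-point-free : ∀ {y} → y ∈ₗ allFin (2 * m) → y ∙ c ≢ y
    ∙c-fixed-point-free {y} _ y∙c≡y = c≢ε (identityʳ-unique y c y∙c≡y)

-- Zero-sum arrays over an abelian group

module AbelianGroupArrays {A : Set} {_∙_ : Op₂ A} {ε : A} {_⁻¹ : Op₁ A}
                          (isAbelianGroup : IsAbelianGroup _≡_ _∙_ ε _⁻¹) where

  private
    G : AbelianGroup _ _
    G = record { isAbelianGroup = isAbelianGroup }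
  open AbelianGroup G using (assoc; identityˡ; identityʳ; inverseʳ)
    renaming (commutativeMonoid to ∙-commutativeMonoid)
  open import Algebra.Properties.AbelianGroup G using (⁻¹-∙-comm; ε⁻¹≈ε)
  open import Algebra.Properties.AbelianGroup G public using (⁻¹-involutive)
  open import Algebra.Properties.CommutativeMonoid.Sum ∙-commutativeMonoid public using (sum)
  open import Algebra.Properties.CommutativeMonoid.Sum ∙-commutativeMonoid
    using (sum-cong-≗; ∑-distrib-+; sum-replicate; sum-replicate-zero)
  open import Algebra.Properties.Monoid.Mult (AbelianGroup.monoid G)
    using (×-assocˡ) renaming (_×_ to _·_)
  open import Algebra.Properties.CommutativeMonoid.Mult ∙-commutativeMonoid using (×-distrib-+)

  bigop≡sum : ∀ {n} (w : Vector A n) → bigop _∙_ ε w ≡ sum w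
  bigop≡sum {ℕ.zero}  w = refl
  bigop≡sum {ℕ.suc n} w = cong (w zero ∙_) (bigop≡sum (tail w))

  sum-++ᵛ : ∀ {m n} (u : Vector A m) (v : Vector A n) → sum (u ++ᵛ v) ≡ sum u ∙ sum v
  sum-++ᵛ {ℕ.zero}  u v = sym (identityˡ (sum v))
  sum-++ᵛ {ℕ.suc m} u v = begin
    u zero ∙ sum (tail (u ++ᵛ v))   ≡⟨ cong (u zero ∙_) (sum-cong-≗ (tail-++ᵛ u v)) ⟩
    u zero ∙ sum (tail u ++ᵛ v)     ≡⟨ cong (u zero ∙_) (sum-++ᵛ (tail u) v) ⟩
    u zero ∙ (sum (tail u) ∙ sum v) ≡⟨ assoc _ _ _ ⟨
    sum u ∙ sum v                   ∎
    where open ≡-Reasoning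

  sum-⁻¹ : ∀ {n} (w : Vector A n) → sum (_⁻¹ ∘ w) ≡ sum w ⁻¹
  sum-⁻¹ {ℕ.zero}  w = sym ε⁻¹≈ε
  sum-⁻¹ {ℕ.suc n} w = trans (cong (w zero ⁻¹ ∙_) (sum-⁻¹ (tail w))) (⁻¹-∙-comm _ _)

  2*k·c≡ε : ∀ k {c} → c ∙ c ≡ ε → (2 * k) · c ≡ ε
  2*k·c≡ε k {c} c∙c≡ε = begin
    (2 * k) · c              ≡⟨ ×-assocˡ c 2 k ⟨
    (k · c) ∙ ((k · c) ∙ ε)  ≡⟨ cong ((k · c) ∙_) (identityʳ _) ⟩
    (k · c) ∙ (k · c)        ≡⟨ ×-distrib-+ c c k ⟨
    k · (c ∙ c)              ≡⟨ cong (k ·_) c∙c≡ε ⟩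
    k · ε                    ≡⟨ sum-replicate k ⟨
    sum (replicate k ε)      ≡⟨ sum-replicate-zero k ⟩
    ε                        ∎
    where open ≡-Reasoning

  sum-∙-involution : ∀ k {c} → c ∙ c ≡ ε → (r : Vector A (2 * k)) → sum (λ i → r i ∙ c) ≡ sum r
  sum-∙-involution k {c} c∙c≡ε r = begin
    sum (λ i → r i ∙ c)                ≡⟨ ∑-distrib-+ r (replicate _ c) ⟩
    sum r ∙ sum (replicate (2 * k) c)  ≡⟨ cong (sum r ∙_) (sum-replicate (2 * k)) ⟩
    sum r ∙ ((2 * k) · c)              ≡⟨ cong (sum r ∙_) (2*k·c≡ε k c∙c≡ε) ⟩
    sum r ∙ ε                          ≡⟨ identityʳ _ ⟩
    sum r                              ∎
    where open ≡-Reasoning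

  -- The trailing []ᵛ is there because 2 * m unfolds to m + (m + 0).
  block : ∀ {m} → Vector A m → Vector A m → Array A 2 (2 * m)
  block u v 0F = u ++ᵛ ((_⁻¹ ∘ v) ++ᵛ []ᵛ)
  block u v 1F = _⁻¹ ∘ block u v 0F

  block-zeroSums : ∀ {m} {u v : Vector A m} → sum u ≡ sum v → ZeroSums _∙_ ε (block u v)
  block-zeroSums {u = u} {v} Σu≡Σv = rows , columns
    where
    open ≡-Reasoning
    sum-row : sum (block u v 0F) ≡ ε
    sum-row = begin
      sum (u ++ᵛ ((_⁻¹ ∘ v) ++ᵛ []ᵛ))  ≡⟨ sum-++ᵛ u _ ⟩
      sum u ∙ sum ((_⁻¹ ∘ v) ++ᵛ []ᵛ)  ≡⟨ cong (sum u ∙_) (sum-++ᵛ (_⁻¹ ∘ v) []ᵛ) ⟩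
      sum u ∙ (sum (_⁻¹ ∘ v) ∙ ε)     ≡⟨ cong (sum u ∙_) (identityʳ _) ⟩
      sum u ∙ sum (_⁻¹ ∘ v)           ≡⟨ cong (sum u ∙_) (sum-⁻¹ v) ⟩
      sum u ∙ (sum v ⁻¹)              ≡⟨ cong (λ s → sum u ∙ (s ⁻¹)) Σu≡Σv ⟨
      sum u ∙ (sum u ⁻¹)              ≡⟨ inverseʳ _ ⟩
      ε                               ∎
    rows : ∀ i → bigop _∙_ ε (block u v i) ≡ ε
    rows 0F = trans (bigop≡sum (block u v 0F)) sum-row
    rows 1F = begin
      bigop _∙_ ε (block u v 1F)  ≡⟨ bigop≡sum (block u v 1F) ⟩
      sum (_⁻¹ ∘ block u v 0F)    ≡⟨ sum-⁻¹ (block u v 0F) ⟩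
      sum (block u v 0F) ⁻¹       ≡⟨ cong _⁻¹ sum-row ⟩
      ε ⁻¹                        ≡⟨ ε⁻¹≈ε ⟩
      ε                           ∎
    columns : ∀ j → bigop _∙_ ε (λ i → block u v i j) ≡ ε
    columns j = trans (cong (_ ∙_) (identityʳ _)) (inverseʳ _)

  private
    rowEntries₀ : ∀ {m} (u v : Vector A m) →
      map (block u v 0F) (allFin _) ≡ toList u ++ (map _⁻¹ (toList v) ++ [])
    rowEntries₀ u v = begin
      map (block u v 0F) (allFin _)                ≡⟨ map-tabulate id (block u v 0F) ⟩
      toList (u ++ᵛ ((_⁻¹ ∘ v) ++ᵛ []ᵛ))            ≡⟨ toList-++ᵛ u _ ⟩
      toList u ++ toList ((_⁻¹ ∘ v) ++ᵛ []ᵛ)        ≡⟨ cong (toList u ++_) (toList-++ᵛ (_⁻¹ ∘ v) []ᵛ) ⟩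
      toList u ++ (toList (_⁻¹ ∘ v) ++ [])         ≡⟨ cong (λ L → toList u ++ (L ++ [])) (map-tabulate v _⁻¹) ⟨
      toList u ++ (map _⁻¹ (toList v) ++ [])       ∎
      where open ≡-Reasoning

    rowEntries₁ : ∀ {m} (u v : Vector A m) →
      map (block u v 1F) (allFin _) ≡ map _⁻¹ (toList u) ++ (toList v ++ [])
    rowEntries₁ u v = begin
      map (_⁻¹ ∘ block u v 0F) (allFin _)               ≡⟨ map-∘ (allFin _) ⟩
      map _⁻¹ (map (block u v 0F) (allFin _))           ≡⟨ cong (map _⁻¹) (rowEntries₀ u v) ⟩
      map _⁻¹ (U ++ (map _⁻¹ V ++ []))                  ≡⟨ map-++ _⁻¹ U _ ⟩
      map _⁻¹ U ++ map _⁻¹ (map _⁻¹ V ++ [])            ≡⟨ cong (map _⁻¹ U ++_) (map-++ _⁻¹ (map _⁻¹ V) []) ⟩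
      map _⁻¹ U ++ (map _⁻¹ (map _⁻¹ V) ++ [])          ≡⟨ cong (λ L → map _⁻¹ U ++ (L ++ [])) V⁻¹⁻¹≡V ⟩
      map _⁻¹ U ++ (V ++ [])                            ∎
      where
      open ≡-Reasoning
      U V : List A
      U = toList u
      V = toList v
      V⁻¹⁻¹≡V : map _⁻¹ (map _⁻¹ V) ≡ V
      V⁻¹⁻¹≡V = trans (sym (map-∘ V)) (trans (map-cong ⁻¹-involutive V) (map-id V))

  arrayEntries-block : ∀ {m} (u v : Vector A m) →
    arrayEntries (block u v) ∼[ bag ] (toList u ++ toList v) ++ map _⁻¹ (toList u ++ toList v)
  arrayEntries-block u v = begin
    arrayEntries (block u v)
      ≡⟨ cong₂ (λ L L′ → L ++ (L′ ++ [])) (rowEntries₀ u v) (rowEntries₁ u v) ⟩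
    (U ++ (V⁻¹ ++ [])) ++ ((U⁻¹ ++ (V ++ [])) ++ [])
      ≈⟨ rearrange U V⁻¹ U⁻¹ V ⟩
    (U ++ V) ++ (U⁻¹ ++ V⁻¹)
      ≡⟨ cong ((U ++ V) ++_) (map-++ _⁻¹ U V) ⟨
    (U ++ V) ++ map _⁻¹ (U ++ V)
      ∎
    where
    open CommutativeMonoidSolver (commutativeMonoid SymmetricKind.bijection A)
      using (solve; _⊜_; _⊕_) renaming (id to [])
    open SetoidReasoning ([ bag ]-Equality A)
    rearrange : ∀ a b c d → (a ++ (b ++ [])) ++ ((c ++ (d ++ [])) ++ []) ∼[ bag ] (a ++ d) ++ (c ++ b)
    rearrange = solve 4 (λ a b c d → (a ⊕ (b ⊕ [])) ⊕ ((c ⊕ (d ⊕ [])) ⊕ []) ⊜ (a ⊕ d) ⊕ (c ⊕ b))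
                  (Setoid.refl ([ bag ]-Equality A))
    U V U⁻¹ V⁻¹ : List A
    U = toList u
    V = toList v
    U⁻¹ = map _⁻¹ U
    V⁻¹ = map _⁻¹ V

module _ {A B : Set} {_∙₁_ : Op₂ A} {ε₁ : A} {_⁻¹₁ : Op₁ A} {_∙₂_ : Op₂ B} {ε₂ : B} {_⁻¹₂ : Op₁ B}
         (G : IsAbelianGroup _≡_ _∙₁_ ε₁ _⁻¹₁) (H : IsAbelianGroup _≡_ _∙₂_ ε₂ _⁻¹₂) where
  private
    module G = IsAbelianGroup G
    module H = IsAbelianGroup H

  ⊕op-isAbelianGroup : IsAbelianGroup _≡_ (_∙₁_ ⊕op _∙₂_) (ε₁ , ε₂) (Product.map _⁻¹₁ _⁻¹₂)
  ⊕op-isAbelianGroup = record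
    { isGroup = record
      { isMonoid = record
        { isSemigroup = record
          { isMagma = record { isEquivalence = isEquivalence ; ∙-cong = cong₂ (_∙₁_ ⊕op _∙₂_) }
          ; assoc = λ (a , b) (c , d) (a′ , b′) → cong₂ _,_ (G.assoc a c a′) (H.assoc b d b′)
          }
        ; identity = (λ (a , b) → cong₂ _,_ (G.identityˡ a) (H.identityˡ b))
                   , (λ (a , b) → cong₂ _,_ (G.identityʳ a) (H.identityʳ b))
        }
      ; inverse = (λ (a , b) → cong₂ _,_ (G.inverseˡ a) (H.inverseˡ b))
                , (λ (a , b) → cong₂ _,_ (G.inverseʳ a) (H.inverseʳ b))
      ; ⁻¹-cong = cong (Product.map _⁻¹₁ _⁻¹₂)
      }
    ; comm = λ (a , b) (c , d) → cong₂ _,_ (G.comm a c) (H.comm b d)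
    }

foldr-⊕op : ∀ {A B : Set} (f : Op₂ A) (g : Op₂ B) (a : A) (b : B) {n} (w : Vector (A × B) n) →
  foldr (f ⊕op g) (a , b) w ≡ (foldr f a (proj₁ ∘ w) , foldr g b (proj₂ ∘ w))
foldr-⊕op f g a b {ℕ.zero}  w = refl
foldr-⊕op f g a b {ℕ.suc n} w = cong ((f ⊕op g) (w zero)) (foldr-⊕op f g a b (tail w))

-- The cyclic group ℤₙ

module ZModProperties (n : ℕ) {{_ : NonZero n}} where
  open ZOps n

  private
    toℕ-mod : ∀ k → toℕ (k mod n) ≡ k % n
    toℕ-mod k = toℕ-fromℕ< _

    mod-cong : ∀ {k l} → k % n ≡ l % n → k mod n ≡ l mod n
    mod-cong eq = toℕ-injective (trans (toℕ-mod _) (trans eq (sym (toℕ-mod _))))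

    %-absorbˡ : ∀ k l → (k % n ℕ.+ l) % n ≡ (k ℕ.+ l) % n
    %-absorbˡ k l = begin
      (k % n ℕ.+ l) % n             ≡⟨ %-distribˡ-+ (k % n) l n ⟩
      (k % n % n ℕ.+ l % n) % n     ≡⟨ cong (λ i → (i ℕ.+ l % n) % n) (m%n%n≡m%n k n) ⟩
      (k % n ℕ.+ l % n) % n         ≡⟨ %-distribˡ-+ k l n ⟨
      (k ℕ.+ l) % n                 ∎
      where open ≡-Reasoning

    %-absorbʳ : ∀ k l → (k ℕ.+ l % n) % n ≡ (k ℕ.+ l) % n
    %-absorbʳ k l = begin
      (k ℕ.+ l % n) % n  ≡⟨ cong (_% n) (+-comm k _) ⟩
      (l % n ℕ.+ k) % n  ≡⟨ %-absorbˡ l k ⟩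
      (l ℕ.+ k) % n      ≡⟨ cong (_% n) (+-comm l k) ⟩
      (k ℕ.+ l) % n      ∎
      where open ≡-Reasoning

    0%n≡0 : 0 % n ≡ 0
    0%n≡0 = m<n⇒m%n≡m (ℕ.>-nonZero⁻¹ n)

  +ᶻ-comm : ∀ x y → x +ᶻ y ≡ y +ᶻ x
  +ᶻ-comm x y = cong (_mod n) (+-comm (toℕ x) (toℕ y))

  +ᶻ-assoc : ∀ x y z → (x +ᶻ y) +ᶻ z ≡ x +ᶻ (y +ᶻ z)
  +ᶻ-assoc x y z = mod-cong (begin
    (toℕ (x +ᶻ y) ℕ.+ toℕ z) % n             ≡⟨ cong (λ i → (i ℕ.+ toℕ z) % n) (toℕ-mod _) ⟩
    ((toℕ x ℕ.+ toℕ y) % n ℕ.+ toℕ z) % n    ≡⟨ %-absorbˡ (toℕ x ℕ.+ toℕ y) (toℕ z) ⟩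
    (toℕ x ℕ.+ toℕ y ℕ.+ toℕ z) % n          ≡⟨ cong (_% n) (+-assoc (toℕ x) _ _) ⟩
    (toℕ x ℕ.+ (toℕ y ℕ.+ toℕ z)) % n        ≡⟨ %-absorbʳ (toℕ x) (toℕ y ℕ.+ toℕ z) ⟨
    (toℕ x ℕ.+ (toℕ y ℕ.+ toℕ z) % n) % n    ≡⟨ cong (λ i → (toℕ x ℕ.+ i) % n) (toℕ-mod _) ⟨
    (toℕ x ℕ.+ toℕ (y +ᶻ z)) % n             ∎)
    where open ≡-Reasoning

  +ᶻ-identityˡ : ∀ x → 0ᶻ +ᶻ x ≡ x
  +ᶻ-identityˡ x = toℕ-injective (begin
    toℕ (0ᶻ +ᶻ x)               ≡⟨ toℕ-mod _ ⟩
    (toℕ 0ᶻ ℕ.+ toℕ x) % n      ≡⟨ cong (λ i → (i ℕ.+ toℕ x) % n) (trans (toℕ-mod 0) 0%n≡0) ⟩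
    toℕ x % n                   ≡⟨ m<n⇒m%n≡m (toℕ<n x) ⟩
    toℕ x                       ∎)
    where open ≡-Reasoning

  +ᶻ-identityʳ : ∀ x → x +ᶻ 0ᶻ ≡ x
  +ᶻ-identityʳ x = trans (+ᶻ-comm x 0ᶻ) (+ᶻ-identityˡ x)

  +ᶻ-inverseʳ : ∀ x → x +ᶻ (-ᶻ x) ≡ 0ᶻ
  +ᶻ-inverseʳ x = mod-cong (begin
    (toℕ x ℕ.+ toℕ (-ᶻ x)) % n       ≡⟨ cong (λ i → (toℕ x ℕ.+ i) % n) (toℕ-mod _) ⟩
    (toℕ x ℕ.+ (n ∸ toℕ x) % n) % n  ≡⟨ %-absorbʳ (toℕ x) (n ∸ toℕ x) ⟩
    (toℕ x ℕ.+ (n ∸ toℕ x)) % n      ≡⟨ cong (_% n) (m+[n∸m]≡n (<⇒≤ (toℕ<n x))) ⟩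
    n % n                           ≡⟨ trans (n%n≡0 n) (sym 0%n≡0) ⟩
    0 % n                           ∎)
    where open ≡-Reasoning

  +ᶻ-isAbelianGroup : IsAbelianGroup _≡_ _+ᶻ_ 0ᶻ -ᶻ_
  +ᶻ-isAbelianGroup = record
    { isGroup = record
      { isMonoid = record
        { isSemigroup = record
          { isMagma = record { isEquivalence = isEquivalence ; ∙-cong = cong₂ _+ᶻ_ }
          ; assoc = +ᶻ-assoc
          }
        ; identity = +ᶻ-identityˡ , +ᶻ-identityʳ
        }
      ; inverse = (λ x → trans (+ᶻ-comm (-ᶻ x) x) (+ᶻ-inverseʳ x)) , +ᶻ-inverseʳ
      ; ⁻¹-cong = cong -ᶻ_
      }
    ; comm = +ᶻ-comm
    }

  private
    ℤₙ : Group _ _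
    ℤₙ = record { isGroup = IsAbelianGroup.isGroup +ᶻ-isAbelianGroup }

  -ᶻ-involutive : ∀ x → -ᶻ (-ᶻ x) ≡ x
  -ᶻ-involutive = ⁻¹-involutive
    where open import Algebra.Properties.Group ℤₙ using (⁻¹-involutive)

  order>2⇒-ᶻg≢g : ∀ {g} → OrderGreaterThan2 g → -ᶻ g ≢ g
  order>2⇒-ᶻg≢g {g} order>2 -ᶻg≡g with g ≟ 0ᶻ
  ... | yes g≡0 = 2≮1 (order>2 1 (s≤s z≤n , trans (+ᶻ-identityʳ g) g≡0 , λ { 1 _ (s≤s ()) }))
    where
    2≮1 : ¬ (2 ℕ.< 1)
    2≮1 (s≤s ())
  ... | no g≢0 = n≮n 2 (order>2 2 (s≤s z≤n , 2·g≡0 , 1·g≢0))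
    where
    2·g≡0 : 2 ·ᶻ g ≡ 0ᶻ
    2·g≡0 = trans (cong (g +ᶻ_) (trans (+ᶻ-identityʳ g) (sym -ᶻg≡g))) (+ᶻ-inverseʳ g)
    1·g≢0 : ∀ j → 0 ℕ.< j → j ℕ.< 2 → j ·ᶻ g ≢ 0ᶻ
    1·g≢0 1 _ _ = g≢0 ∘ trans (sym (+ᶻ-identityʳ g))
    1·g≢0 (ℕ.suc (ℕ.suc _)) _ (s≤s (s≤s ()))

-- Zero-sum blocks over A ⊕ Ψ

module ZeroSumBlocks {A : Set} {_+_ : Op₂ A} {0# : A} { -_ : Op₁ A}
                     (A-isAbelianGroup : IsAbelianGroup _≡_ _+_ 0# -_)
                     {k : ℕ} {_∙_ : Op₂ (Fin (2 * (2 * k)))} {ε : Fin (2 * (2 * k))} {_⁻¹ : Op₁ (Fin (2 * (2 * k)))}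
                     (Ψ-isAbelianGroup : IsAbelianGroup _≡_ _∙_ ε _⁻¹) where

  private
    Ψ : Set
    Ψ = Fin (2 * (2 * k))

    Ψ-isGroup : IsGroup _≡_ _∙_ ε _⁻¹
    Ψ-isGroup = IsAbelianGroup.isGroup Ψ-isAbelianGroup

    module Ψ = AbelianGroupArrays Ψ-isAbelianGroup
    module A⊕Ψ = AbelianGroupArrays (⊕op-isAbelianGroup A-isAbelianGroup Ψ-isAbelianGroup)

    involution : ∃ λ c → c ≢ ε × c ∙ c ≡ ε
    involution = ∃-order-2 {2 * k} Ψ-isGroup

    c : Ψ
    c = proj₁ involution

    c∙c≡ε : c ∙ c ≡ ε
    c∙c≡ε = proj₂ (proj₂ involution)

    transversal : ∃ λ (r : Vector Ψ (2 * k)) → toList r ++ map (_∙ c) (toList r) ∼[ bag ] allFin _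
    transversal = cosetTransversal {2 * k} Ψ-isGroup (proj₁ (proj₂ involution)) c∙c≡ε

    r : Vector Ψ (2 * k)
    r = proj₁ transversal

  zeroSumBlock : A → Array (A × Ψ) 2 (2 * (2 * k))
  zeroSumBlock x = A⊕Ψ.block ((x ,_) ∘ r) ((x ,_) ∘ (_∙ c) ∘ r)

  zeroSumBlock-zeroSums : ∀ x → ZeroSums (_+_ ⊕op _∙_) (0# , ε) (zeroSumBlock x)
  zeroSumBlock-zeroSums x = A⊕Ψ.block-zeroSums {2 * k} (begin
    A⊕Ψ.sum ((x ,_) ∘ r)                                       ≡⟨ foldr-⊕op _+_ _∙_ 0# ε ((x ,_) ∘ r) ⟩
    (foldr _+_ 0# (replicate (2 * k) x) , Ψ.sum r)             ≡⟨ cong (_ ,_) (Ψ.sum-∙-involution k c∙c≡ε r) ⟨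
    (foldr _+_ 0# (replicate (2 * k) x) , Ψ.sum ((_∙ c) ∘ r))  ≡⟨ foldr-⊕op _+_ _∙_ 0# ε ((x ,_) ∘ (_∙ c) ∘ r) ⟨
    A⊕Ψ.sum ((x ,_) ∘ (_∙ c) ∘ r)                              ∎)
    where open ≡-Reasoning

  arrayEntries-zeroSumBlock : ∀ x →
    arrayEntries (zeroSumBlock x) ∼[ bag ] map (x ,_) (allFin _) ++ map (- x ,_) (allFin _)
  arrayEntries-zeroSumBlock x = begin
    arrayEntries (zeroSumBlock x)
      ≈⟨ A⊕Ψ.arrayEntries-block u v ⟩
    (toList u ++ toList v) ++ map negate (toList u ++ toList v)
      ≡⟨ cong (λ L → L ++ map negate L) u++v≡x×W ⟩
    map (x ,_) W ++ map negate (map (x ,_) W)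
      ≡⟨ cong (map (x ,_) W ++_) (map-∘ W) ⟨
    map (x ,_) W ++ map (λ y → - x , y ⁻¹) W
      ≈⟨ ++-cong (map⁺-∼bag (x ,_) W∼Ψ) (map⁺-∼bag (λ y → - x , y ⁻¹) W∼Ψ) ⟩
    map (x ,_) (allFin _) ++ map (λ y → - x , y ⁻¹) (allFin _)
      ≡⟨ cong (map (x ,_) (allFin _) ++_) (map-∘ (allFin _)) ⟩
    map (x ,_) (allFin _) ++ map (- x ,_) (map _⁻¹ (allFin _))
      ≈⟨ ++-cong ∼-refl (map⁺-∼bag (- x ,_) (map-involution-allFin Ψ.⁻¹-involutive)) ⟩
    map (x ,_) (allFin _) ++ map (- x ,_) (allFin _)
      ∎
    where
    open SetoidReasoning ([ bag ]-Equality (A × Ψ))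
    open Setoid ([ bag ]-Equality (A × Ψ)) using () renaming (refl to ∼-refl)
    negate : A × Ψ → A × Ψ
    negate = Product.map -_ _⁻¹
    u v : Vector (A × Ψ) (2 * k)
    u = (x ,_) ∘ r
    v = (x ,_) ∘ (_∙ c) ∘ r
    W : List Ψ
    W = toList r ++ map (_∙ c) (toList r)
    W∼Ψ : W ∼[ bag ] allFin _
    W∼Ψ = proj₂ transversal
    u++v≡x×W : toList u ++ toList v ≡ map (x ,_) W
    u++v≡x×W = sym (trans (map-++ (x ,_) (toList r) _) (cong₂ _++_
      (map-tabulate r (x ,_))
      (trans (sym (map-∘ (toList r))) (map-tabulate r ((x ,_) ∘ (_∙ c))))))

lemma4p6 : (a : ℕ) → {{_ : NonZero a}} → let open Z2a a in (Ω : Subset (2 * a)) →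
    (∀ g → g ∈ Ω → OrderGreaterThan2 g × (-ᶻ g) ∈ Ω) →
    (α : ℕ) → 2 ≤ α →
    (_∙_ : Op₂ (Fin (2 ^ α))) (ε : Fin (2 ^ α)) (_⁻¹ : Op₁ (Fin (2 ^ α))) →
    IsAbelianGroup _≡_ _∙_ ε _⁻¹ →
    ∃ λ (T : Fin ⌊ ∣ Ω ∣ /2⌋ → Array (ZMod (2 * a) × Fin (2 ^ α)) 2 (2 ^ α)) →
    (∀ t → ZeroSums (_+ᶻ_ ⊕op _∙_) (0ᶻ , ε) (T t)) ×
    (entries T ↭ concatMap (λ x → map (x ,_) (allFin (2 ^ α))) (elements Ω))
lemma4p6 a Ω Ω-closed (ℕ.suc (ℕ.suc α)) (s≤s (s≤s z≤n)) _∙_ ε _⁻¹ Ψ-isAbelianGroup =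
  zeroSumBlock ∘ g , zeroSumBlock-zeroSums ∘ g , ∼bag⇒↭ (begin
    entries (zeroSumBlock ∘ g)
      ≡⟨ entries-∘ zeroSumBlock g ⟩
    concatMap (arrayEntries ∘ zeroSumBlock) (toList g)
      ≈⟨ concatMap-cong-∼bag (toList g) arrayEntries-zeroSumBlock ⟩
    concatMap (λ x → fibre x ++ fibre (-ᶻ x)) (toList g)
      ≈⟨ concatMap-orbits {σ = -ᶻ_} {ys = toList g} g++-g∼Ω ⟩
    concatMap fibre (elements Ω)
      ∎)
  where
  open Z2a a
  open ZModProperties (2 * a) {{nonZero-2* a}} using (+ᶻ-isAbelianGroup; -ᶻ-involutive; order>2⇒-ᶻg≢g)
  open ZeroSumBlocks +ᶻ-isAbelianGroup {2 ^ α} Ψ-isAbelianGroup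
  open Orbits -ᶻ_ -ᶻ-involutive
  open SetoidReasoning ([ bag ]-Equality _)

  fibre : ZMod (2 * a) → List (ZMod (2 * a) × Fin (2 ^ ℕ.suc (ℕ.suc α)))
  fibre x = map (x ,_) (allFin _)

  negationTransversal :
    ∃ λ (g : Vector (ZMod (2 * a)) ⌊ ∣ Ω ∣ /2⌋) → toList g ++ map -ᶻ_ (toList g) ∼[ bag ] elements Ω
  negationTransversal = orbitTransversal (elements! Ω)
    (λ y∈Ω → ∈-elements⁺ (proj₂ (Ω-closed _ (∈-elements⁻ y∈Ω))))
    (λ y∈Ω → order>2⇒-ᶻg≢g (proj₁ (Ω-closed _ (∈-elements⁻ y∈Ω))))
    (cong ⌊_/2⌋ (length-elements Ω))

  g : Vector (ZMod (2 * a)) ⌊ ∣ Ω ∣ /2⌋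
  g = proj₁ negationTransversal

  g++-g∼Ω : toList g ++ map -ᶻ_ (toList g) ∼[ bag ] elements Ω
  g++-g∼Ω = proj₂ negationTransversal
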